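{- Let $T$ be a string and $i$ a position in $T$. Let $M_1=T[i_1..e_1]$, $M_2=T[i_2..e_2]$, $M_3=T[i_3..e_3]$ be three MUSs of $T$, each containing position $i$, with $i_1<i_2<i_3$. For $k\in\{1,2,3\}$ let $a_k=T[i_k]$ and $s_k=T[i_k+1..e_k]$. Let $u=T[i_3+1..e_1]$ (so that $a_3u=T[i_3..e_1]$ is the common overlap of $M_1,M_2,M_3$), let $q=T[i_1+1..i_3]$ and $p=T[i_2+1..i_3]$. Let $S_1=[i'_1..i'_1+|s_1|-1]$, $S_2=[i'_2..i'_2+|s_2|-1]$, $S_3=[i'_3..i'_3+|s_3|-1]$ be any occurrences in $T$ of $s_1,s_2,s_3$ respectively such that $i'_1\ne i_1+1$, $i'_2\ne i_2+1$ and $i'_3\ne i_3+1$. Consider the three occurrences of $u$ given by $U_1=[i'_1+|q|..i'_1+|q|+|u|-1]$, $U_2=[i'_2+|p|..i'_2+|p|+|u|-1]$, $U_3=[i'_3..i'_3+|u|-1]$. Then at least two of $U_1,U_2,U_3$ do not overlap.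
   Context: Strings are finite sequences over an alphabet $\Sigma$. For a string $T$ of length $n$, $T[i]$ is its $i$-th character and $T[i..j]$ is the substring from position $i$ to position $j$ (empty if $i>j$). An interval $[i..j]$ is an occurrence of a string $w$ in $T$ if $T[i..j]=w$; $\mathsf{occ}_T(w)$ is the number of occurrences of $w$ in $T$, with the convention $\mathsf{occ}_T(\varepsilon)=|T|+1$. A substring $w$ of $T$ is unique if $\mathsf{occ}_T(w)=1$. A unique substring $w$ of $T$ is a minimal unique substring (MUS) of $T$ if $\mathsf{occ}_T(w[1..|w|-1])\ge 2$ and $\mathsf{occ}_T(w[2..|w|])\ge 2$; a MUS is identified with its unique occurrence $[k..j]$, and it contains position $i$ if $k\le i\le j$. Two intervals overlap if they share at least one position. -}

module Defs where

open import Data.Nat using (ℕ; zero; suc; _+_; _∸_; _≤_; _<_)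
open import Data.List using (List; length; take; drop; filter; map; upTo)
open import Data.List.Properties using (≡-dec)
open import Data.Product using (Σ; _×_)
open import Relation.Binary.Definitions using (DecidableEquality)
open import Relation.Binary.PropositionalEquality using (_≡_)

-- Strings are lists; positions are 1-indexed as in the paper.

module _ {A : Set} (_≟_ : DecidableEquality A) where

  -- T[i..j] (empty if i > j); position i of T is list index i ∸ 1.
  substr : List A → ℕ → ℕ → List A
  substr T i j = take (suc j ∸ i) (drop (i ∸ 1) T)

  OccursAt : List A → List A → ℕ → Set
  OccursAt T w k = (1 ≤ k) × (k + length w ≤ suc (length T)) × (substr T k (k + length w ∸ 1) ≡ w)

  -- occ_T(w): the number of start positions k ∈ {1,…,|T|+1} at which w occurs.
  -- (For w = ε this is |T|+1, matching the paper's convention.)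
  occ : List A → List A → ℕ
  occ T w = length (filter (λ k → ≡-dec _≟_ (take (length w) (drop (k ∸ 1) T)) w)
                           (map suc (upTo (suc (length T)))))

  IsMUS : List A → ℕ → ℕ → Set
  IsMUS T k j = (1 ≤ k) × (k ≤ j) × (j ≤ length T)
              × (occ T (substr T k j) ≡ 1)
              × (2 ≤ occ T (substr T k (j ∸ 1)))
              × (2 ≤ occ T (substr T (suc k) j))

Overlap : (s₁ l₁ s₂ l₂ : ℕ) → Set
Overlap s₁ l₁ s₂ l₂ = Σ ℕ λ x → (s₁ ≤ x) × (x < s₁ + l₁) × (s₂ ≤ x) × (x < s₂ + l₂)

-- Uniqueness of M₂
-- and M₃ forces e₁ < e₂ < e₃ (otherwise M₂ recurs inside the copy of s₁, or M₃ inside that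
-- of s₂). Hence the copies of s₁ and s₂ give occurrences U₁, U₂ of u preceded by p, which ends
-- with a₃ (and for U₁ even by a₂p), while the copy of s₃ gives an occurrence U₃ of uw₂ that is
-- not preceded by a₃, since a₃s₃ is unique. Two overlapping occurrences of a factor at distance e
-- make every occurrence of it e-periodic; so if U₁, U₂, U₃ pairwise overlap, many letters are
-- forced equal. If U₃ is not the leftmost of the three, this puts a₃ before U₃. Otherwise compare
-- U₃ with the starts of the two copies of p: if one starts left of U₃, again a₃ precedes U₃; if
-- both start right of it, a₂ precedes the copy of s₂; if the copy in front of U₁ starts at U₃,
-- the two periods propagate a copy of s₂ to U₃, preceded by a₂; if the copy in front of U₂
-- starts at U₃, then a₂ = a₃ while s₂ and s₃ both occur at U₃, so M₂ or M₃ recurs.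
module Submission where

open import Defs
open import Data.Nat using (ℕ; zero; suc; _+_; _∸_; _⊓_; _≤_; _<_; s≤s; z≤n; s<s⁻¹; _≟_; _<?_)
open import Data.Nat.Properties
open import Data.Nat.Induction using (<-wellFounded)
open import Data.Nat.Tactic.RingSolver using (solve)
open import Data.List using (List; []; _∷_; length; take; drop; head; upTo; map; filter)
open import Data.List.Properties using (length-take; length-drop; drop-drop; ≡-dec)
open import Data.List.Membership.Propositional using (_∈_)
open import Data.List.Membership.Propositional.Properties using (∈-filter⁺; ∈-map⁺; ∈-upTo⁺; ∈-length)
open import Data.List.Relation.Unary.Any using (here; there)
open import Data.Maybe using (Maybe; nothing)
open import Data.Maybe.Properties using (just-injective)
open import Data.Product using (∃; _×_; _,_)
open import Data.Sum using (_⊎_; inj₁; inj₂)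
open import Data.Empty using (⊥; ⊥-elim)
open import Function using (_∘_)
open import Induction.WellFounded using (Acc; acc)
open import Relation.Nullary using (¬_; Dec; yes; no)
open import Relation.Nullary.Decidable using (_×-dec_)
open import Relation.Binary.Definitions using (DecidableEquality; tri<; tri≈; tri>)
open import Relation.Binary.PropositionalEquality

m<n⇒∃[o]m+suc[o]≡n : ∀ {m n} → m < n → ∃ λ o → m + suc o ≡ n
m<n⇒∃[o]m+suc[o]≡n {m} m<n with m≤n⇒∃[o]m+o≡n m<n
... | o , eq = o , trans (+-suc m o) eq

m+n≡o⇒o∸m≡n : ∀ m {n o} → m + n ≡ o → o ∸ m ≡ n
m+n≡o⇒o∸m≡n m {n} refl = m+n∸m≡n m n

Close : ℕ → ℕ → ℕ → Set
Close a b n = a < b + n × b < a + n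

Close-resp : ∀ {a a′ b b′ n n′} → a ≡ a′ → b ≡ b′ → n ≡ n′ → Close a b n → Close a′ b′ n′
Close-resp refl refl refl C = C

module _ {X : Set} (c : ℕ → X) where

  Agree : ℕ → ℕ → ℕ → Set
  Agree x y n = ∀ j → j < n → c (x + j) ≡ c (y + j)

  Unique : ℕ → ℕ → Set
  Unique i n = ∀ x → Agree x i n → x ≡ i

  Agree-refl : ∀ x {n} → Agree x x n
  Agree-refl x j _ = refl

  Agree-sym : ∀ {x y n} → Agree x y n → Agree y x n
  Agree-sym A j j<n = sym (A j j<n)

  Agree-trans : ∀ {x y z n} → Agree x y n → Agree y z n → Agree x z n
  Agree-trans A B j j<n = trans (A j j<n) (B j j<n)

  Agree-respˡ : ∀ {x x′ y n} → x ≡ x′ → Agree x y n → Agree x′ y n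
  Agree-respˡ refl A = A

  Agree-≤ : ∀ {x y m n} → m ≤ n → Agree x y n → Agree x y m
  Agree-≤ m≤n A j j<m = A j (<-≤-trans j<m m≤n)

  Agree-drop : ∀ {x y} k {n} → Agree x y (k + n) → Agree (x + k) (y + k) n
  Agree-drop {x} {y} k A j j<n = begin
    c (x + k + j)   ≡⟨ cong c (+-assoc x k j) ⟩
    c (x + (k + j)) ≡⟨ A (k + j) (+-monoʳ-< k j<n) ⟩
    c (y + (k + j)) ≡⟨ cong c (+-assoc y k j) ⟨
    c (y + k + j)   ∎
    where open ≡-Reasoning

  Agree-head : ∀ {x y n} → Agree x y (suc n) → c x ≡ c y
  Agree-head {x} {y} A =
    subst₂ (λ a b → c a ≡ c b) (+-identityʳ x) (+-identityʳ y) (A 0 (s≤s z≤n))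

  Agree-tail : ∀ {x y n} → Agree x y (suc n) → Agree (suc x) (suc y) n
  Agree-tail {x} {y} A j j<n =
    subst₂ (λ a b → c a ≡ c b) (+-suc x j) (+-suc y j) (A (suc j) (s≤s j<n))

  Agree-cons : ∀ {x y n} → c x ≡ c y → Agree (suc x) (suc y) n → Agree x y (suc n)
  Agree-cons {x} {y} x≈y A zero _ =
    subst₂ (λ a b → c a ≡ c b) (sym (+-identityʳ x)) (sym (+-identityʳ y)) x≈y
  Agree-cons {x} {y} x≈y A (suc j) (s≤s j<n) =
    subst₂ (λ a b → c a ≡ c b) (sym (+-suc x j)) (sym (+-suc y j)) (A j j<n)

  Agree-period : ∀ {q p o e n y} → Agree q o n → Agree p o n → Agree (p + e) o n →
                 q ≤ y → y + e < q + n → c y ≡ c (y + e)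
  Agree-period {q} {p} {o} {e} {n} Q P Pe q≤y y+e<q+n with m≤n⇒∃[o]m+o≡n q≤y
  ... | j , refl = begin
    c (q + j)       ≡⟨ Q j j<n ⟩
    c (o + j)       ≡⟨ Pe j j<n ⟨
    c (p + e + j)   ≡⟨ cong c (solve (p ∷ e ∷ j ∷ [])) ⟩
    c (p + (j + e)) ≡⟨ P (j + e) j+e<n ⟩
    c (o + (j + e)) ≡⟨ Q (j + e) j+e<n ⟨
    c (q + (j + e)) ≡⟨ cong c (+-assoc q j e) ⟨
    c (q + j + e)   ∎
    where
    open ≡-Reasoning
    j+e<n : j + e < n
    j+e<n = +-cancelˡ-< q (j + e) n (subst (_< q + n) (+-assoc q j e) y+e<q+n)
    j<n : j < n
    j<n = ≤-<-trans (m≤m+n j e) j+e<n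

  private
    letters-before-agree-≤ : ∀ d {q o n y y′} →
      Agree q o n → Agree (d + y) o n → Agree (d + y′) o n → q ≤ y → y ≤ y′ → y′ < q + n → c y ≡ c y′
    letters-before-agree-≤ d {y = y} Q Y Y′ q≤y y≤y′ y′<q+n with m≤n⇒∃[o]m+o≡n y≤y′
    ... | e , refl = Agree-period Q Y (Agree-respˡ (sym (+-assoc d y e)) Y′) q≤y y′<q+n

  letters-before-agree : ∀ d {q o n y y′} → Agree q o n → Agree (d + y) o n → Agree (d + y′) o n →
                         q ≤ y → q ≤ y′ → y < q + n → y′ < q + n → c y ≡ c y′
  letters-before-agree d Q Y Y′ q≤y q≤y′ y<q+n y′<q+n with ≤-total _ _
  ... | inj₁ y≤y′ = letters-before-agree-≤ d Q Y Y′ q≤y y≤y′ y′<q+n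
  ... | inj₂ y′≤y = sym (letters-before-agree-≤ d Q Y′ Y q≤y′ y′≤y y<q+n)

  Agree-period-extend : ∀ {s n} a t → Agree s (s + (a + suc t)) n → Agree s (s + a) (a + suc t) →
                        Agree s (s + a) (suc t + n)
  Agree-period-extend {s} {n} a t long short j j< = go j (<-wellFounded j) j<
    where
    go : ∀ j → Acc _<_ j → j < suc t + n → c (s + j) ≡ c (s + a + j)
    go j (acc rec) j< with j <? a + suc t
    ... | yes j<a+t+1 = short j j<a+t+1
    ... | no j≮a+t+1 with m≤n⇒∃[o]m+o≡n (≮⇒≥ j≮a+t+1)
    ... | k , refl = begin
      c (s + (a + suc t + k))       ≡⟨ cong c (+-assoc s (a + suc t) k) ⟨
      c (s + (a + suc t) + k)       ≡⟨ long k k<n ⟨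
      c (s + k)                     ≡⟨ go k (rec k<j) (<-trans k<n (m<n+m n (s≤s z≤n))) ⟩
      c (s + a + k)                 ≡⟨ cong c (+-assoc s a k) ⟩
      c (s + (a + k))               ≡⟨ long (a + k) a+k<n ⟩
      c (s + (a + suc t) + (a + k)) ≡⟨ cong c (solve (s ∷ a ∷ t ∷ k ∷ [])) ⟩
      c (s + a + (a + suc t + k))   ∎
      where
      open ≡-Reasoning
      regroup : a + suc t + k ≡ suc t + (a + k)
      regroup = solve (a ∷ t ∷ k ∷ [])
      a+k<n : a + k < n
      a+k<n = +-cancelˡ-< (suc t) (a + k) n (subst (_< suc t + n) regroup j<)
      k<n : k < n
      k<n = ≤-<-trans (m≤n+m k a) a+k<n
      k<j : k < a + suc t + k
      k<j = m<n+m k (≤-trans (s≤s z≤n) (m≤n+m (suc t) a))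

  Unique-not-inside-copy : ∀ {o x} k {n m} → Unique (o + k) n → Agree x o m → x ≢ o → m < k + n
  Unique-not-inside-copy k U A x≢o with k + _ ≤? _
  ... | yes k+n≤m = ⊥-elim (x≢o (+-cancelʳ-≡ k _ _ (U _ (Agree-drop k (Agree-≤ k+n≤m A)))))
  ... | no k+n≰m  = ≰⇒> k+n≰m

  Unique-longer-than-copy : ∀ {i y m n} → Unique i m → Agree y i n → y ≢ i → n < m
  Unique-longer-than-copy {i} {m = m} U =
    Unique-not-inside-copy 0 (subst (λ o → Unique o m) (sym (+-identityʳ i)) U)

  Unique-common-occurrence : ∀ {i i′ x n n′} → Unique i (suc n) → Unique i′ (suc n′) →
                             Agree x (suc i) n → Agree x (suc i′) n′ → c i ≡ c i′ → i ≡ i′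
  Unique-common-occurrence {n = n} {n′} U U′ A A′ i≈i′ with n ≤? n′
  ... | yes n≤n′ = sym (U _ (Agree-cons (sym i≈i′) (Agree-trans (Agree-sym (Agree-≤ n≤n′ A′)) A)))
  ... | no n≰n′  = U′ _ (Agree-cons i≈i′ (Agree-trans (Agree-sym (Agree-≤ (≰⇒≥ n≰n′) A)) A′))

  letter-before-suffix-occurrence : ∀ {x x′ y b g n} →
    Agree x b (suc g + n) → Agree x′ b (suc g + n) → Agree (suc y) (b + suc g) n →
    x < x′ → x′ ≤ x + n → x ≤ y → y ≤ x + g → c y ≡ c (b + g)
  letter-before-suffix-occurrence {x} {b = b} {g} {n} X X′ Y x<x′ x′≤x+n x≤y y≤x+g
    with m≤n⇒∃[o]m+o≡n x<x′ | m≤n⇒∃[o]m+o≡n x≤y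
  ... | e , refl | h , refl = begin
    c (x + h)           ≡⟨ Agree-period X X X′ₑ (m≤m+n x h) (shift x h h+e+1<) ⟩
    c (x + h + suc e)   ≡⟨ cong c (+-suc (x + h) e) ⟩
    c (suc (x + h) + e) ≡⟨ Y e e<n ⟩
    c (b + suc g + e)   ≡⟨ cong c (solve (b ∷ g ∷ e ∷ [])) ⟩
    c (b + g + suc e)   ≡⟨ Agree-period (Agree-refl b) X X′ₑ (m≤m+n b g) (shift b g g+e+1<) ⟨
    c (b + g)           ∎
    where
    open ≡-Reasoning
    X′ₑ : Agree (x + suc e) b (suc g + n)
    X′ₑ = Agree-respˡ (sym (+-suc x e)) X′
    e<n : e < n
    e<n = +-cancelˡ-≤ x (suc e) n (subst (_≤ x + n) (sym (+-suc x e)) x′≤x+n)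
    shift : ∀ z j → j + suc e < suc g + n → z + j + suc e < z + (suc g + n)
    shift z j lt = subst (_< z + (suc g + n)) (sym (+-assoc z j (suc e))) (+-monoʳ-< z lt)
    g+e+1< : g + suc e < suc g + n
    g+e+1< = s≤s (+-monoʳ-≤ g e<n)
    h+e+1< : h + suc e < suc g + n
    h+e+1< = ≤-<-trans (+-monoˡ-≤ (suc e) (+-cancelˡ-≤ x h g y≤x+g)) g+e+1<

  -- With v = c[b .. b + t] and a = s′ − s: the copies of vu at s and s′ give period a near s,
  -- the copies of uw at s and s′ + |v| give period a + |v| along uw, and the former period
  -- spreads along the latter.
  copy-extends : ∀ {s s′ b t n r} →
    Agree s b (suc t + n) → Agree s′ b (suc t + n + r) → Agree s (b + suc t) (n + r) →
    s ≤ s′ → s′ ≤ s + n → Agree s b (suc t + n + r)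
  copy-extends {s} {b = b} {t} {n} {r} X X′ Y s≤s′ s′≤s+n with m≤n⇒∃[o]m+o≡n s≤s′
  ... | a , refl = Agree-trans (subst (Agree s (s + a)) (sym (+-assoc (suc t) n r)) extended) X′
    where
    X′ᵣ : Agree (s + a) b (suc t + (n + r))
    X′ᵣ = subst (Agree (s + a) b) (+-assoc (suc t) n r) X′
    long : Agree s (s + (a + suc t)) (n + r)
    long = Agree-trans Y (Agree-sym (Agree-respˡ (+-assoc s a (suc t)) (Agree-drop (suc t) X′ᵣ)))
    a≤n : a ≤ n
    a≤n = +-cancelˡ-≤ s a n s′≤s+n
    short : Agree s (s + a) (a + suc t)
    short = Agree-≤ (subst (_≤ suc t + n) (+-comm (suc t) a) (+-monoʳ-≤ (suc t) a≤n))
                    (Agree-trans X (Agree-sym (Agree-≤ (m≤m+n _ r) X′)))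
    extended : Agree s (s + a) (suc t + (n + r))
    extended = Agree-period-extend a t long short

  -- Around a₂ = c i₂ the text reads a₂ p u w₂, where p has length suc g and ends with
  -- a₃ = c i₃, u has length L and w₂ length r; s₃ = u w₃ has length N. Copies of a₂pu, of
  -- s₂ = puw₂ and of s₃ start at y₁, 1 + y₂ and 1 + y₃; U z is where u starts in a copy of
  -- pu starting at z.
  module ThreeCopies
    (i₂ g L r N y₁ y₂ y₃ : ℕ)
    (a₂pu-at-y₁  : Agree y₁ i₂ (suc (suc g + L)))           (y₁≢i₂ : y₁ ≢ i₂)
    (puw-at-1+y₂ : Agree (suc y₂) (suc i₂) (suc g + L + r))  (y₂≢i₂ : y₂ ≢ i₂)
    (uw-at-1+y₃  : Agree (suc y₃) (suc (i₂ + suc g)) N)      (y₃≢i₃ : y₃ ≢ i₂ + suc g)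
    (L+r≤N : L + r ≤ N)
    (M₂-unique : Unique i₂ (suc (suc g + L + r)))
    (M₃-unique : Unique (i₂ + suc g) (suc N))
    where

    i₃ : ℕ
    i₃ = i₂ + suc g

    U : ℕ → ℕ
    U z = z + suc g

    U-cancel : ∀ {z z′} → U z < U z′ + L → z < z′ + L
    U-cancel {z} {z′} lt = +-cancelʳ-< (suc g) z (z′ + L) (subst (U z <_) regroup lt)
      where
      regroup : z′ + suc g + L ≡ z′ + L + suc g
      regroup = solve (z′ ∷ g ∷ L ∷ [])

    pu-at-1+y₁ : Agree (suc y₁) (suc i₂) (suc g + L)
    pu-at-1+y₁ = Agree-tail a₂pu-at-y₁

    pu-at-1+y₂ : Agree (suc y₂) (suc i₂) (suc g + L)
    pu-at-1+y₂ = Agree-≤ (m≤m+n _ r) puw-at-1+y₂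

    u-after-p : ∀ {z} → Agree z (suc i₂) (suc g + L) → Agree (U z) (suc i₃) L
    u-after-p = Agree-drop (suc g)

    a₃-before-u : ∀ {z} → Agree z (suc i₂) (suc g + L) → c (z + g) ≡ c i₃
    a₃-before-u P = trans (P _ (s≤s (m≤m+n _ L))) (cong c (sym (+-suc i₂ g)))

    u-at-1+y₃ : Agree (suc y₃) (suc i₃) L
    u-at-1+y₃ = Agree-≤ (≤-trans (m≤m+n L r) L+r≤N) uw-at-1+y₃

    a₂-at-y₁ : c y₁ ≡ c i₂
    a₂-at-y₁ = Agree-head a₂pu-at-y₁

    a₂-not-before-1+y₂ : c y₂ ≢ c i₂
    a₂-not-before-1+y₂ a₂ = y₂≢i₂ (M₂-unique y₂ (Agree-cons a₂ puw-at-1+y₂))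

    a₃-not-before-1+y₃ : c y₃ ≢ c i₃
    a₃-not-before-1+y₃ a₃ = y₃≢i₃ (M₃-unique y₃ (Agree-cons a₃ uw-at-1+y₃))

    p-copies-distinct : y₁ ≢ y₂
    p-copies-distinct y₁≡y₂ = a₂-not-before-1+y₂ (subst (λ y → c y ≡ c i₂) y₁≡y₂ a₂-at-y₁)

    a₃-before-u₃ : ∀ {z z′} → Agree z (suc i₂) (suc g + L) → Agree z′ (suc i₂) (suc g + L) →
                   z < z′ → U z′ < U z + L → z ≤ y₃ → suc y₃ < U z + L → c y₃ ≡ c i₃
    a₃-before-u₃ {z} {z′} P P′ z<z′ U′<U+L z≤y₃ U₃<U+L with y₃ ≤? z + g
    ... | yes y₃≤z+g = trans
      (letter-before-suffix-occurrence P P′ u-at-1+y₃ z<z′ (<⇒≤ (U-cancel U′<U+L)) z≤y₃ y₃≤z+g)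
      (cong c (sym (+-suc i₂ g)))
    ... | no y₃≰z+g = trans
      (letters-before-agree 1 (u-after-p P) u-at-1+y₃ (Agree-respˡ (+-suc z′ g) (u-after-p P′))
        (subst (_≤ y₃) (sym (+-suc z g)) (≰⇒> y₃≰z+g))
        (subst (_≤ z′ + g) (sym (+-suc z g)) (+-monoˡ-≤ g z<z′))
        (<-trans (n<1+n y₃) U₃<U+L)
        (<-trans (+-monoʳ-< z′ (n<1+n g)) U′<U+L))
      (a₃-before-u P′)

    p-copies-after-u₃ : y₃ < y₁ → y₃ < y₂ → U (suc y₁) < suc y₃ + L → U (suc y₂) < suc y₃ + L → ⊥
    p-copies-after-u₃ y₃<y₁ y₃<y₂ U₁<U₃+L U₂<U₃+L =
      a₂-not-before-1+y₂ (trans (sym same-letter) a₂-at-y₁)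
      where
      u-at : ∀ {y} → Agree (suc y) (suc i₂) (suc g + L) → Agree (suc (suc g) + y) (suc i₃) L
      u-at {y} P = Agree-respˡ (cong suc (trans (+-suc y g) (cong suc (+-comm y g)))) (u-after-p P)
      same-letter : c y₁ ≡ c y₂
      same-letter = letters-before-agree (suc (suc g)) u-at-1+y₃ (u-at pu-at-1+y₁) (u-at pu-at-1+y₂)
        y₃<y₁ y₃<y₂ (<-trans (s≤s (m≤m+n y₁ (suc g))) U₁<U₃+L)
                    (<-trans (s≤s (m≤m+n y₂ (suc g))) U₂<U₃+L)

    p₁-copy-at-u₃ : y₁ ≡ y₃ → y₁ < y₂ → U (suc y₂) < U (suc y₁) + L → ⊥
    p₁-copy-at-u₃ refl y₁<y₂ U₂<U₁+L = y₁≢i₂ (M₂-unique y₁ (Agree-cons a₂-at-y₁ puw-at-1+y₁))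
      where
      puw-at-1+y₁ : Agree (suc y₁) (suc i₂) (suc g + L + r)
      puw-at-1+y₁ = copy-extends pu-at-1+y₁ puw-at-1+y₂ (Agree-≤ L+r≤N uw-at-1+y₃)
                      (<⇒≤ (s≤s y₁<y₂)) (<⇒≤ (U-cancel U₂<U₁+L))

    p₂-copy-at-u₃ : y₂ ≡ y₃ → y₂ < y₁ → U (suc y₁) < suc y₃ + L → ⊥
    p₂-copy-at-u₃ refl y₂<y₁ U₁<U₃+L = <⇒≢ (m<m+n i₂ (s≤s z≤n))
      (Unique-common-occurrence M₂-unique M₃-unique puw-at-1+y₂ uw-at-1+y₃ a₂≡a₃)
      where
      a₂≡a₃ : c i₂ ≡ c i₃
      a₂≡a₃ = begin
        c i₂           ≡⟨ a₂-at-y₁ ⟨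
        c y₁           ≡⟨ Agree-period u-at-1+y₃ u-at-1+y₃ (u-after-p pu-at-1+y₂) y₂<y₁
                                       (<-trans (n<1+n _) U₁<U₃+L) ⟩
        c (y₁ + suc g) ≡⟨ cong c (+-suc y₁ g) ⟩
        c (suc y₁ + g) ≡⟨ a₃-before-u {suc y₁} pu-at-1+y₁ ⟩
        c i₃           ∎
        where open ≡-Reasoning

    not-pairwise-close : Close (U (suc y₁)) (U (suc y₂)) L → Close (U (suc y₁)) (suc y₃) L →
                         Close (U (suc y₂)) (suc y₃) L → ⊥
    not-pairwise-close (U₁<U₂+L , U₂<U₁+L) (U₁<U₃+L , U₃<U₁+L) (U₂<U₃+L , U₃<U₂+L)
      with <-cmp y₁ y₂
    ... | tri≈ _ y₁≡y₂ _ = p-copies-distinct y₁≡y₂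
    ... | tri< y₁<y₂ _ _ with <-cmp y₁ y₃
    ...   | tri< y₁<y₃ _ _ =
      a₃-not-before-1+y₃ (a₃-before-u₃ pu-at-1+y₁ pu-at-1+y₂ (s≤s y₁<y₂) U₂<U₁+L y₁<y₃ U₃<U₁+L)
    ...   | tri≈ _ y₁≡y₃ _ = p₁-copy-at-u₃ y₁≡y₃ y₁<y₂ U₂<U₁+L
    ...   | tri> _ _ y₃<y₁ = p-copies-after-u₃ y₃<y₁ (<-trans y₃<y₁ y₁<y₂) U₁<U₃+L U₂<U₃+L
    not-pairwise-close (U₁<U₂+L , U₂<U₁+L) (U₁<U₃+L , U₃<U₁+L) (U₂<U₃+L , U₃<U₂+L)
      | tri> _ _ y₂<y₁ with <-cmp y₂ y₃
    ...   | tri< y₂<y₃ _ _ =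
      a₃-not-before-1+y₃ (a₃-before-u₃ pu-at-1+y₂ pu-at-1+y₁ (s≤s y₂<y₁) U₁<U₂+L y₂<y₃ U₃<U₂+L)
    ...   | tri≈ _ y₂≡y₃ _ = p₂-copy-at-u₃ y₂≡y₃ y₂<y₁ U₁<U₃+L
    ...   | tri> _ _ y₃<y₂ = p-copies-after-u₃ (<-trans y₃<y₂ y₂<y₁) y₃<y₂ U₁<U₃+L U₂<U₃+L

  u-copies-not-pairwise-close : ∀ {i₂ g L m N y₁ y₂ y₃} →
    Agree y₁ i₂ (suc (suc g + L)) → y₁ ≢ i₂ →
    Agree (suc y₂) (suc i₂) m → y₂ ≢ i₂ →
    Agree (suc y₃) (suc (i₂ + suc g)) N → y₃ ≢ i₂ + suc g →
    Unique i₂ (suc m) → Unique (i₂ + suc g) (suc N) →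
    Close (suc y₁ + suc g) (suc y₂ + suc g) L → Close (suc y₁ + suc g) (suc y₃) L →
    Close (suc y₂ + suc g) (suc y₃) L → ⊥
  u-copies-not-pairwise-close {i₂} {g} {L} {_} {N} {y₁} {y₂} {y₃} S₁ y₁≢i₂ S₂ y₂≢i₂ S₃ y₃≢i₃ U₂ U₃
    with m≤n⇒∃[o]m+o≡n (<⇒≤ (s<s⁻¹ (Unique-longer-than-copy U₂ S₁ y₁≢i₂)))
  ... | r , refl =
    ThreeCopies.not-pairwise-close i₂ g L r N y₁ y₂ y₃ S₁ y₁≢i₂ S₂ y₂≢i₂ S₃ y₃≢i₃ L+r≤N U₂ U₃
    where
    M₃-beyond-s₂ : suc g + L + r < g + suc N
    M₃-beyond-s₂ = Unique-not-inside-copy g (subst (λ i → Unique i (suc N)) (+-suc i₂ g) U₃) S₂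
                                            (y₂≢i₂ ∘ suc-injective)
    L+r≤N : L + r ≤ N
    L+r≤N = <⇒≤ (+-cancelˡ-< g (L + r) N
                  (s<s⁻¹ (subst₂ _<_ (cong suc (+-assoc g L r)) (+-suc g N) M₃-beyond-s₂)))

module _ {A : Set} where

  -- Positions are 1-based as in Defs: position 0, like any position past the end, has no letter.
  charAt : List A → ℕ → Maybe A
  charAt T zero    = nothing
  charAt T (suc k) = head (drop k T)

  head-drop-take : ∀ n (xs : List A) j → j < n → head (drop j (take n xs)) ≡ head (drop j xs)
  head-drop-take (suc n) []       zero    _         = refl
  head-drop-take (suc n) []       (suc j) _         = refl
  head-drop-take (suc n) (x ∷ xs) zero    _         = refl
  head-drop-take (suc n) (x ∷ xs) (suc j) (s≤s j<n) = head-drop-take n xs j j<n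

  take-ext : ∀ n (xs ys : List A) → (∀ j → j < n → head (drop j xs) ≡ head (drop j ys)) →
             take n xs ≡ take n ys
  take-ext zero    xs       ys       _ = refl
  take-ext (suc n) []       []       _ = refl
  take-ext (suc n) []       (y ∷ ys) h with () ← h 0 (s≤s z≤n)
  take-ext (suc n) (x ∷ xs) []       h with () ← h 0 (s≤s z≤n)
  take-ext (suc n) (x ∷ xs) (y ∷ ys) h =
    cong₂ _∷_ (just-injective (h 0 (s≤s z≤n))) (take-ext n xs ys (λ j → h (suc j) ∘ s≤s))

  head-drop-≥ : ∀ m (xs : List A) → length xs ≤ m → head (drop m xs) ≡ nothing
  head-drop-≥ zero    []       _        = refl
  head-drop-≥ (suc m) []       _        = refl
  head-drop-≥ (suc m) (x ∷ xs) (s≤s le) = head-drop-≥ m xs le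

  head-drop-< : ∀ m (xs : List A) → m < length xs → head (drop m xs) ≢ nothing
  head-drop-< zero    (x ∷ xs) _        ()
  head-drop-< (suc m) (x ∷ xs) (s≤s lt) = head-drop-< m xs lt

  Agree⇒take≡ : ∀ {T x y n} → Agree (charAt T) (suc x) (suc y) n →
                take n (drop x T) ≡ take n (drop y T)
  Agree⇒take≡ {T} {x} {y} {n} A = take-ext n _ _ λ j j<n →
    trans (cong head (drop-drop x j T)) (trans (A j j<n) (cong head (sym (drop-drop y j T))))

  take≡⇒Agree : ∀ {T x y n} → take n (drop x T) ≡ take n (drop y T) →
                Agree (charAt T) (suc x) (suc y) n
  take≡⇒Agree {T} {x} {y} {n} eq j j<n = begin
    head (drop (x + j) T)             ≡⟨ cong head (drop-drop x j T) ⟨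
    head (drop j (drop x T))          ≡⟨ head-drop-take n (drop x T) j j<n ⟨
    head (drop j (take n (drop x T))) ≡⟨ cong (head ∘ drop j) eq ⟩
    head (drop j (take n (drop y T))) ≡⟨ head-drop-take n (drop y T) j j<n ⟩
    head (drop j (drop y T))          ≡⟨ cong head (drop-drop y j T) ⟩
    head (drop (y + j) T)             ∎
    where open ≡-Reasoning

distinct-members⇒2≤length : ∀ {x y : ℕ} {xs : List ℕ} → x ∈ xs → y ∈ xs → x ≢ y → 2 ≤ length xs
distinct-members⇒2≤length (here refl) (here refl) x≢y = ⊥-elim (x≢y refl)
distinct-members⇒2≤length (here _)    (there y∈)  _   = s≤s (∈-length y∈)
distinct-members⇒2≤length (there x∈)  _           _   = s≤s (∈-length x∈)

module _ {A : Set} (_≟ᴬ_ : DecidableEquality A) where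

  length-substr : ∀ (T : List A) i e → e ≤ length T → length (substr _≟ᴬ_ T (suc i) e) ≡ e ∸ i
  length-substr T i e e≤|T| = begin
    length (take (e ∸ i) (drop i T)) ≡⟨ length-take (e ∸ i) (drop i T) ⟩
    (e ∸ i) ⊓ length (drop i T)      ≡⟨ cong ((e ∸ i) ⊓_) (length-drop i T) ⟩
    (e ∸ i) ⊓ (length T ∸ i)         ≡⟨ m≤n⇒m⊓n≡m (∸-monoˡ-≤ i e≤|T|) ⟩
    e ∸ i                            ∎
    where open ≡-Reasoning

  OccursAt⇒Agree : ∀ T i e {x} → e ≤ length T → OccursAt _≟ᴬ_ T (substr _≟ᴬ_ T (suc i) e) x →
                   Agree (charAt T) x (suc i) (e ∸ i)
  OccursAt⇒Agree T i e {zero} _ (() , _)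
  OccursAt⇒Agree T i e {suc x} e≤|T| (_ , _ , copy) = take≡⇒Agree {T = T} {x} {i} (begin
    take (e ∸ i) (drop x T)            ≡⟨ cong (λ m → take m (drop x T)) |w|≡ ⟨
    take (x + length w ∸ x) (drop x T) ≡⟨ copy ⟩
    w                                  ∎)
    where
    open ≡-Reasoning
    w : List A
    w = substr _≟ᴬ_ T (suc i) e
    |w|≡ : x + length w ∸ x ≡ e ∸ i
    |w|≡ = trans (m+n∸m≡n x (length w)) (length-substr T i e e≤|T|)

  IsMUS⇒Unique : ∀ {T k j} → IsMUS _≟ᴬ_ T k j → Unique (charAt T) k (suc (j ∸ k))
  IsMUS⇒Unique {T} {suc k} {j} (_ , k<j , j≤|T| , occ≡1 , _) = unique
    where
    k<|T| : k < length T
    k<|T| = ≤-trans k<j j≤|T|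
    w : List A
    w = substr _≟ᴬ_ T (suc k) j
    P? : (z : ℕ) → Dec (take (length w) (drop (z ∸ 1) T) ≡ w)
    P? z = ≡-dec _≟ᴬ_ (take (length w) (drop (z ∸ 1) T)) w
    counted : ∀ {z} → Agree (charAt T) (suc z) (suc k) (suc (j ∸ suc k)) →
              suc z ∈ filter P? (map suc (upTo (suc (length T))))
    counted {z} B = ∈-filter⁺ P? (∈-map⁺ suc (∈-upTo⁺ (≤-trans z<|T| (n≤1+n _)))) copy
      where
      z<|T| : z < length T
      z<|T| with z <? length T
      ... | yes z<|T| = z<|T|
      ... | no z≮|T|  = ⊥-elim (head-drop-< k T k<|T|
                          (trans (sym (Agree-head (charAt T) {suc z} {suc k} B))
                                 (head-drop-≥ z T (≮⇒≥ z≮|T|))))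
      copy : take (length w) (drop z T) ≡ w
      copy = trans (cong (λ n → take n (drop z T)) (length-substr T k j j≤|T|))
                   (Agree⇒take≡ {T = T} {z} {k}
                     (subst (Agree (charAt T) (suc z) (suc k)) (sym (+-∸-assoc 1 k<j)) B))
    unique : Unique (charAt T) (suc k) (suc (j ∸ suc k))
    unique zero    A = ⊥-elim (head-drop-< k T k<|T| (sym (Agree-head (charAt T) {0} {suc k} A)))
    unique (suc x) A with x ≟ k
    ... | yes refl = refl
    ... | no x≢k   = ⊥-elim (<-irrefl refl (subst (1 <_) occ≡1
                       (distinct-members⇒2≤length (counted {x} A)
                          (counted {k} (Agree-refl (charAt T) (suc k))) (x≢k ∘ suc-injective))))

  MUS-u-copies-not-pairwise-close : ∀ T {i₁ e₁ i₂ e₂ i₃ e₃ x₁ x₂ x₃} →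
    IsMUS _≟ᴬ_ T i₁ e₁ → IsMUS _≟ᴬ_ T i₂ e₂ → IsMUS _≟ᴬ_ T i₃ e₃ →
    i₁ < i₂ → i₂ < i₃ → i₃ ≤ e₁ →
    OccursAt _≟ᴬ_ T (substr _≟ᴬ_ T (suc i₁) e₁) x₁ →
    OccursAt _≟ᴬ_ T (substr _≟ᴬ_ T (suc i₂) e₂) x₂ →
    OccursAt _≟ᴬ_ T (substr _≟ᴬ_ T (suc i₃) e₃) x₃ →
    x₁ ≢ suc i₁ → x₂ ≢ suc i₂ → x₃ ≢ suc i₃ →
    Close (x₁ + (i₃ ∸ i₁)) (x₂ + (i₃ ∸ i₂)) (e₁ ∸ i₃) →
    Close (x₁ + (i₃ ∸ i₁)) x₃ (e₁ ∸ i₃) →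
    Close (x₂ + (i₃ ∸ i₂)) x₃ (e₁ ∸ i₃) → ⊥
  MUS-u-copies-not-pairwise-close T {i₁} {e₁} {i₂} {e₂} {i₃} {e₃} {suc y₁} {suc y₂} {suc y₃}
    (_ , _ , e₁≤|T| , _) M₂@(_ , _ , e₂≤|T| , _) M₃@(_ , _ , e₃≤|T| , _)
    i₁<i₂ i₂<i₃ i₃≤e₁ O₁ O₂ O₃ x₁≢ x₂≢ x₃≢ C₁₂ C₁₃ C₂₃
    with m≤n⇒∃[o]m+o≡n i₁<i₂ | m<n⇒∃[o]m+suc[o]≡n i₂<i₃ | m≤n⇒∃[o]m+o≡n i₃≤e₁
  ... | a , refl | g , refl | L , refl =
    u-copies-not-pairwise-close c a₂pu-copy (x₁≢ ∘ +-cancelʳ-≡ a _ _)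
      (OccursAt⇒Agree T i₂ e₂ e₂≤|T| O₂) (x₂≢ ∘ cong suc)
      (OccursAt⇒Agree T i₃ e₃ e₃≤|T| O₃) (x₃≢ ∘ cong suc)
      (IsMUS⇒Unique M₂) (IsMUS⇒Unique M₃)
      (Close-resp U₁≡ U₂≡ L≡ C₁₂) (Close-resp U₁≡ refl L≡ C₁₃) (Close-resp U₂≡ refl L≡ C₂₃)
    where
    c : ℕ → Maybe A
    c = charAt T
    a₂pu-copy : Agree c (suc y₁ + a) (suc i₁ + a) (suc (suc g + L))
    a₂pu-copy = Agree-drop c {suc y₁} {suc i₁} a (subst (Agree c (suc y₁) (suc i₁))
                  (m+n≡o⇒o∸m≡n i₁ e₁-offset) (OccursAt⇒Agree T i₁ e₁ e₁≤|T| O₁))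
      where
      e₁-offset : i₁ + (a + suc (suc g + L)) ≡ suc i₁ + a + suc g + L
      e₁-offset = solve (i₁ ∷ a ∷ g ∷ L ∷ [])
    U₁≡ : suc y₁ + (suc i₁ + a + suc g ∸ i₁) ≡ suc (suc y₁ + a) + suc g
    U₁≡ = trans (cong (suc y₁ +_) (m+n≡o⇒o∸m≡n i₁ i₃-offset)) U₁-shape
      where
      i₃-offset : i₁ + (suc a + suc g) ≡ suc i₁ + a + suc g
      i₃-offset = solve (i₁ ∷ a ∷ g ∷ [])
      U₁-shape : suc y₁ + (suc a + suc g) ≡ suc (suc y₁ + a) + suc g
      U₁-shape = solve (y₁ ∷ a ∷ g ∷ [])
    U₂≡ : suc y₂ + (suc i₁ + a + suc g ∸ (suc i₁ + a)) ≡ suc y₂ + suc g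
    U₂≡ = cong (suc y₂ +_) (m+n∸m≡n (suc i₁ + a) (suc g))
    L≡ : suc i₁ + a + suc g + L ∸ (suc i₁ + a + suc g) ≡ L
    L≡ = m+n∸m≡n (suc i₁ + a + suc g) L

Overlap⇒Close : ∀ {s s′ n} → Overlap s n s′ n → Close s s′ n
Overlap⇒Close (_ , s≤x , x<s+n , s′≤x , x<s′+n) = ≤-<-trans s≤x x<s′+n , ≤-<-trans s′≤x x<s+n

Close? : ∀ a b n → Dec (Close a b n)
Close? a b n = (a <? b + n) ×-dec (b <? a + n)

some-pair-disjoint : ∀ {a b d n} → (Close a b n → Close a d n → Close b d n → ⊥) →
  (¬ Overlap a n b n) ⊎ (¬ Overlap a n d n) ⊎ (¬ Overlap b n d n)
some-pair-disjoint {a} {b} {d} {n} not-all with Close? a b n | Close? a d n | Close? b d n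
... | no ¬ab | _      | _      = inj₁ (¬ab ∘ Overlap⇒Close)
... | yes _  | no ¬ad | _      = inj₂ (inj₁ (¬ad ∘ Overlap⇒Close))
... | yes _  | yes _  | no ¬bd = inj₂ (inj₂ (¬bd ∘ Overlap⇒Close))
... | yes ab | yes ad | yes bd = ⊥-elim (not-all ab ad bd)

lemma1 : {A : Set} (_≟_ : DecidableEquality A) (T : List A) (i i₁ e₁ i₂ e₂ i₃ e₃ : ℕ) →
  1 ≤ i → i ≤ length T →
  IsMUS _≟_ T i₁ e₁ → IsMUS _≟_ T i₂ e₂ → IsMUS _≟_ T i₃ e₃ →
  i₁ ≤ i → i ≤ e₁ → i₂ ≤ i → i ≤ e₂ → i₃ ≤ i → i ≤ e₃ →
  i₁ < i₂ → i₂ < i₃ →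
  (i₁′ i₂′ i₃′ : ℕ) →
  OccursAt _≟_ T (substr _≟_ T (suc i₁) e₁) i₁′ →
  OccursAt _≟_ T (substr _≟_ T (suc i₂) e₂) i₂′ →
  OccursAt _≟_ T (substr _≟_ T (suc i₃) e₃) i₃′ →
  i₁′ ≢ suc i₁ → i₂′ ≢ suc i₂ → i₃′ ≢ suc i₃ →
  let u = substr _≟_ T (suc i₃) e₁
      q = substr _≟_ T (suc i₁) i₃
      p = substr _≟_ T (suc i₂) i₃
      U₁ = i₁′ + length q
      U₂ = i₂′ + length p
      U₃ = i₃′
  in (¬ Overlap U₁ (length u) U₂ (length u))
     ⊎ (¬ Overlap U₁ (length u) U₃ (length u))
     ⊎ (¬ Overlap U₂ (length u) U₃ (length u))
lemma1 _≟_ T _ i₁ e₁ i₂ _ i₃ _ _ i≤|T| M₁@(_ , _ , e₁≤|T| , _) M₂ M₃ _ i≤e₁ _ _ i₃≤i _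
       i₁<i₂ i₂<i₃ _ _ _ O₁ O₂ O₃ x₁≢ x₂≢ x₃≢
  rewrite length-substr _≟_ T i₃ e₁ e₁≤|T|
        | length-substr _≟_ T i₁ i₃ (≤-trans i₃≤i i≤|T|)
        | length-substr _≟_ T i₂ i₃ (≤-trans i₃≤i i≤|T|)
  = some-pair-disjoint
      (MUS-u-copies-not-pairwise-close _≟_ T M₁ M₂ M₃ i₁<i₂ i₂<i₃ (≤-trans i₃≤i i≤e₁)
                                       O₁ O₂ O₃ x₁≢ x₂≢ x₃≢)
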